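{- Let $\mathcal{R}$ be a finite set of unlabeled rules, $G$ an unlabeled attributed graph, and $M\subseteq\mathrm{Match}_{\mathcal{R}}(G)$. Then the following are equivalent: (i) $M$ is regular; (ii) $M$ is parallel coherent; (iii) $M$ has the effective deletion property.
   Context: Fix a many-sorted signature $\Sigma$ and a set $\mathscr{V}$ of sorted variables disjoint from $\Sigma$; $T_\Sigma(X)$ is the term algebra over a finite $X\subseteq\mathscr{V}$, and $|\mathcal{A}|$ denotes the disjoint union of the carriers of a $\Sigma$-algebra $\mathcal{A}$. An attributed graph $G=(V_G,A_G,s_G,t_G,\mathcal{A}_G,l_G)$ consists of sets $V_G$ (vertices) and $A_G$ (arrows), source and target functions $s_G,t_G:A_G\to V_G$, a $\Sigma$-algebra $\mathcal{A}_G$, and an attribution $l_G:V_G\cup A_G\to\mathcal{P}(|\mathcal{A}_G|)$, with $V_G,A_G,|\mathcal{A}_G|$ pairwise disjoint. $G$ is unlabeled if $l_G(x)=\varnothing$ for all $x\in V_G\cup A_G$. $H\lhd G$ ($H$ is a subgraph of $G$) if $V_H\subseteq V_G$, $A_H\subseteq A_G$, $s_H,t_H$ are restrictions of $s_G,t_G$, $\mathcal{A}_H=\mathcal{A}_G$, and $l_H(x)\subseteq l_G(x)$ for all $x\in V_H\cup A_H$. A morphism $\alpha:H\to G$ is a function from $V_H\cup A_H\cup|\mathcal{A}_H|$ to $V_G\cup A_G\cup|\mathcal{A}_G|$ mapping vertices to vertices and arrows to arrows with $s_G\circ\alpha=\alpha\circ s_H$, $t_G\circ\alpha=\alpha\circ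 t_H$, whose restriction $\alpha_{\mathcal{A}}$ to $|\mathcal{A}_H|$ is a $\Sigma$-homomorphism into $\mathcal{A}_G$, and with $\alpha_{\mathcal{A}}(l_H(x))\subseteq l_G(\alpha(x))$. For $F\lhd H$, $\alpha(F)$ is the smallest subgraph of $G$ such that $\alpha$ restricted to $F$ is a morphism $F\to\alpha(F)$. A matching is a morphism injective on vertices and arrows. Attributions are combined pointwise, an attribution of a subgraph being extended by $\varnothing$. Graphs $H,G$ are joinable if $\mathcal{A}_H=\mathcal{A}_G$, $V_H\cap A_G=A_H\cap V_G=\varnothing$, and $s_H,s_G$ (resp. $t_H,t_G$) agree on $A_H\cap A_G$; then $H\sqcap G$ has vertices $V_H\cap V_G$, arrows $A_H\cap A_G$, the common source/target maps, algebra $\mathcal{A}_H$ and attribution $l_H\cap l_G$, and $H\sqcup G$ has vertices $V_H\cup V_G$, arrows $A_H\cup A_G$, the joined source/target maps, algebra $\mathcal{A}_H$ and attribution $l_H\cup l_G$; $\bigsqcup_{i}G_i$ is defined likewise for pairwise joinable families with a common algebra. $G$ is disjoint from $V,A,l$ ($V,A$ sets, $l$ an attribution) if $V_G\cap V=\varnothing$, $A_G\cap A=\varnothing$ and $l_G(x)\cap l(x)=\varnothing$ for all $x\in V_G\cup A_G$; $G\setminus(V,A,l)$ denotes the largest subgraph of $G$ disjoint from $V,A,l$. A $(\Sigma,X)$-graph is a finite graph with algebra $T_\Sigma(X)$. A rule is a triple $r=(L,K,R)$ of $(\Sigma,X)$-graphs with $L,R$ joinable, $L\sqcap R\lhd K\lhd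 L$, and $X$ equal to the set of variables occurring in attributes of $L$; it is unlabeled if $L,K,R$ are unlabeled. A matching of $r$ in $G$ is a matching $\mu:L\to G$ that is consistent: $\mu_{\mathcal{A}}(l_L(x)\setminus l_K(x))\cap\mu_{\mathcal{A}}(l_K(x))=\varnothing$ for all $x\in V_K\cup A_K$. $\mathcal{R}$ is a finite set of rules whose distinct members have distinct left-hand-side carriers; $\mathrm{Match}_{\mathcal{R}}(G)$ is the (disjoint) union of the sets of matchings of its rules in $G$, and for $\mu\in\mathrm{Match}_{\mathcal{R}}(G)$ its rule is written $(L_\mu,K_\mu,R_\mu)$. For such $\mu$ define $\mu^{\uparrow}$ on $R_\mu$: it equals $\mu_{\mathcal{A}}$ on the algebra, $\mu^{\uparrow}(x)=\mu(x)$ if $x\in V_{K_\mu}\cup A_{K_\mu}$, and $\mu^{\uparrow}(x)=(x,\mu)$ (a fresh item) otherwise; $\mu^{\uparrow}(R_\mu)$ is the graph with vertices $\mu(V_{R_\mu}\cap V_{K_\mu})\cup((V_{R_\mu}\setminus V_{K_\mu})\times\{\mu\})$, arrows defined similarly, source $\mu^{\uparrow}\circ s_{R_\mu}\circ(\mu^{\uparrow})^{ -1}$, target likewise, algebra $\mathcal{A}_G$, attribution $\mu_{\mathcal{A}}\circ l_{R_\mu}\circ(\mu^{\uparrow})^{ -1}$. For $M\subseteq\mathrm{Match}_{\mathcal{R}}(G)$ let $V^-_M=\bigcup_{\mu\in M}\mu(V_{L_\mu}\setminus V_{K_\mu})$, $A^-_M=\bigcup_{\mu\in M}\mu(A_{L_\mu}\setminus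 A_{K_\mu})$, $l^-_M(x)=\bigcup\{\mu_{\mathcal{A}}(l_{L_\mu}(y)\setminus l_{K_\mu}(y)) : \mu\in M,\ \mu(y)=x\}$, $l^+_M(x)=\bigcup\{\mu_{\mathcal{A}}(l_{R_\mu}(y)\setminus l_{K_\mu}(y)) : \mu\in M,\ \mu(y)=x\}$ (with $l_{R_\mu}(y)=\varnothing$ if $y\notin R_\mu$), and $G_M=\big(G\setminus(V^-_M,A^-_M,l^-_M)\big)\sqcup\bigsqcup_{\mu\in M}\mu^{\uparrow}(R_\mu)$. $M$ is regular if $G_M$ is disjoint from $V^-_M,A^-_M,l^-_M$. $M$ is parallel coherent if $\nu(R_\nu\sqcap K_\nu)\sqcap\mu(L_\mu)\lhd\mu(K_\mu)$ for all $\mu,\nu\in M$. $M$ has the effective deletion property if $G_M$ is disjoint from $V^-_M,A^-_M,l^-_M\setminus l^+_M$. -}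

module Defs where

open import Data.Bool using (Bool; true; false; T)
open import Data.Nat using (ℕ)
open import Data.Fin using (Fin)
open import Data.List using (List; _∷_)
open import Data.List.Relation.Unary.All as All using (All)
open import Data.List.Membership.Propositional using (_∈_)
open import Data.Product using (Σ; _×_; _,_; proj₁; proj₂)
open import Data.Sum using (_⊎_; inj₁; inj₂)
open import Relation.Binary.PropositionalEquality using (_≡_)
open import Relation.Nullary using (¬_)
open import Data.Empty using (⊥)
open import Function.Bundles using (_⇔_)

record Signature : Set₁ where
  field
    Sort   : Set
    Op     : Set
    arity  : Op → List Sort
    result : Op → Sort

-- the set 𝒱 of sorted variables (disjoint from Σ: automatic, it is a separate type)
record Variables (Sig : Signature) : Set₁ where
  open Signature Sig
  field
    Var    : Set
    sortOf : Var → Sort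

module Theory (Sig : Signature) (𝒱 : Variables Sig) where
  open Signature Sig
  open Variables 𝒱

  record Algebra : Set₁ where
    field
      Carrier : Sort → Set
      apply   : (f : Op) → All Carrier (arity f) → Carrier (result f)
  open Algebra public

  ∣_∣ : Algebra → Set
  ∣ 𝒜 ∣ = Σ Sort (Carrier 𝒜)

  record Hom (𝒜 ℬ : Algebra) : Set where
    field
      hom    : ∀ {s} → Carrier 𝒜 s → Carrier ℬ s
      hom-op : ∀ f (as : All (Carrier 𝒜) (arity f)) →
               hom (apply 𝒜 f as) ≡ apply ℬ f (All.map hom as)
  open Hom public

  hImg : {𝒜 ℬ : Algebra} → Hom 𝒜 ℬ → (∣ 𝒜 ∣ → Set) → ∣ ℬ ∣ → Set
  hImg {𝒜} φ P (s , b) = Σ (Carrier 𝒜 s) λ a → P (s , a) × hom φ a ≡ b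

  data Term (X : Var → Bool) : Sort → Set where
    var : (x : Var) → T (X x) → Term X (sortOf x)
    app : (f : Op) → All (Term X) (arity f) → Term X (result f)

  TermAlg : (Var → Bool) → Algebra
  TermAlg X = record { Carrier = Term X ; apply = app }

  data Occurs {X : Var → Bool} (x : Var) : {s : Sort} → Term X s → Set
  data OccursAll {X : Var → Bool} (x : Var) : {ss : List Sort} → All (Term X) ss → Set
  data Occurs {X} x where
    here   : (p : T (X x)) → Occurs x (var x p)
    inside : ∀ {f} {ts : All (Term X) (arity f)} → OccursAll x ts → Occurs x (app f ts)
  data OccursAll {X} x where
    hd : ∀ {s ss} {t : Term X s} {ts : All (Term X) ss} → Occurs x t → OccursAll x (t All.∷ ts)
    tl : ∀ {s ss} {t : Term X s} {ts : All (Term X) ss} → OccursAll x ts → OccursAll x (t All.∷ ts)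

  record Graph : Set₁ where
    field
      V   : Set
      A   : Set
      src : A → V
      tgt : A → V
      alg : Algebra
      lab : V ⊎ A → ∣ alg ∣ → Set
  open Graph public

  Unlabeled : Graph → Set
  Unlabeled G = ∀ x c → ¬ lab G x c

  -- Rules.  The joinable graphs L, R (and K) are represented as subgraphs
  -- of their join L ⊔ R, a finite graph with vertices Fin nV, arrows Fin nA.

  Mem : {n m : ℕ} → (Fin n → Bool) → (Fin m → Bool) → Fin n ⊎ Fin m → Set
  Mem PV PA (inj₁ v) = T (PV v)
  Mem PV PA (inj₂ a) = T (PA a)

  record Rule : Set₁ where
    field
      X        : Var → Bool
      X-finite : Σ (List Var) λ xs → ∀ x → T (X x) → x ∈ xs
      nV nA    : ℕ
      rsrc rtgt : Fin nA → Fin nV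
      LV KV RV : Fin nV → Bool
      LA KA RA : Fin nA → Bool
      lL lK lR : Fin nV ⊎ Fin nA → ∣ TermAlg X ∣ → Set
    InL : Fin nV ⊎ Fin nA → Set
    InL = Mem LV LA
    InK : Fin nV ⊎ Fin nA → Set
    InK = Mem KV KA
    InR : Fin nV ⊎ Fin nA → Set
    InR = Mem RV RA
    field
      L-src : ∀ a → T (LA a) → T (LV (rsrc a))
      L-tgt : ∀ a → T (LA a) → T (LV (rtgt a))
      K-src : ∀ a → T (KA a) → T (KV (rsrc a))
      K-tgt : ∀ a → T (KA a) → T (KV (rtgt a))
      R-src : ∀ a → T (RA a) → T (RV (rsrc a))
      R-tgt : ∀ a → T (RA a) → T (RV (rtgt a))
      cover : ∀ y → InL y ⊎ InR y
      KV⊆LV : ∀ v → T (KV v) → T (LV v)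
      KA⊆LA : ∀ a → T (KA a) → T (LA a)
      lK⊆lL : ∀ y → InK y → ∀ t → lK y t → lL y t
      LR⊆K  : ∀ y → InL y → InR y → InK y
      lLR⊆lK : ∀ y → InL y → InR y → ∀ t → lL y t → lR y t → lK y t
      X-vars : ∀ x → T (X x) ⇔
               Σ (Fin nV ⊎ Fin nA) λ y → InL y × Σ ∣ TermAlg X ∣ λ t → lL y t × Occurs x (proj₂ t)

  K⊆L : (r : Rule) → ∀ y → Rule.InK r y → Rule.InL r y
  K⊆L r (inj₁ v) = Rule.KV⊆LV r v
  K⊆L r (inj₂ a) = Rule.KA⊆LA r a

  UnlabeledRule : Rule → Set
  UnlabeledRule r = (∀ y → InL y → ∀ t → ¬ lL y t)
                  × (∀ y → InK y → ∀ t → ¬ lK y t)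
                  × (∀ y → InR y → ∀ t → ¬ lR y t)
    where open Rule r

  itemMap : {n m : ℕ} {LV : Fin n → Bool} {LA : Fin m → Bool} {B C : Set} →
            ((v : Fin n) → T (LV v) → B) → ((a : Fin m) → T (LA a) → C) →
            (y : Fin n ⊎ Fin m) → Mem LV LA y → B ⊎ C
  itemMap mV mA (inj₁ v) p = inj₁ (mV v p)
  itemMap mV mA (inj₂ a) p = inj₂ (mA a p)

  record Matching (r : Rule) (G : Graph) : Set where
    open Rule r
    field
      mV   : (v : Fin nV) → T (LV v) → Graph.V G
      mA   : (a : Fin nA) → T (LA a) → Graph.A G
      mAlg : Hom (TermAlg X) (alg G)
    mI : (y : Fin nV ⊎ Fin nA) → InL y → Graph.V G ⊎ Graph.A G
    mI = itemMap mV mA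
    field
      m-src : ∀ a (p : T (LA a)) → Graph.src G (mA a p) ≡ mV (rsrc a) (L-src a p)
      m-tgt : ∀ a (p : T (LA a)) → Graph.tgt G (mA a p) ≡ mV (rtgt a) (L-tgt a p)
      m-lab : ∀ y (p : InL y) → ∀ c → hImg mAlg (lL y) c → lab G (mI y p) c
      injV  : ∀ v p v' p' → mV v p ≡ mV v' p' → v ≡ v'
      injA  : ∀ a p a' p' → mA a p ≡ mA a' p' → a ≡ a'
      consistent : ∀ y → InK y → ∀ c →
                   hImg mAlg (λ t → lL y t × ¬ lK y t) c → hImg mAlg (lK y) c → ⊥

  -- Graphs presented over an ambient carrier (used for G_M and G ∖ (V,A,l))

  record PGraph (𝒜 : Algebra) (VT AT : Set) : Set₁ where
    field
      src tgt : AT → VT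
      Vs  : VT → Set
      As  : AT → Set
      lab : VT ⊎ AT → ∣ 𝒜 ∣ → Set

  InP : {𝒜 : Algebra} {VT AT : Set} (P : PGraph 𝒜 VT AT) → VT ⊎ AT → Set
  InP P (inj₁ v) = PGraph.Vs P v
  InP P (inj₂ a) = PGraph.As P a

  module Parallel {k : ℕ} (ℛ : Fin k → Rule) (G : Graph) where

    Match : Set
    Match = Σ (Fin k) λ i → Matching (ℛ i) G

    rl : Match → Rule
    rl μ = ℛ (proj₁ μ)

    mt : (μ : Match) → Matching (rl μ) G
    mt μ = proj₂ μ

    RItem : Match → Set
    RItem μ = Fin (Rule.nV (rl μ)) ⊎ Fin (Rule.nA (rl μ))

    GItem : Set
    GItem = V G ⊎ A G

    MSet : Set₁
    MSet = Match → Set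

    module _ (M : MSet) where

      V⁻ : V G → Set
      V⁻ v = Σ Match λ μ → M μ × Σ (Fin (Rule.nV (rl μ))) λ y →
             Σ (T (Rule.LV (rl μ) y)) λ p → ¬ T (Rule.KV (rl μ) y) × Matching.mV (mt μ) y p ≡ v

      A⁻ : A G → Set
      A⁻ a = Σ Match λ μ → M μ × Σ (Fin (Rule.nA (rl μ))) λ y →
             Σ (T (Rule.LA (rl μ) y)) λ p → ¬ T (Rule.KA (rl μ) y) × Matching.mA (mt μ) y p ≡ a

      l⁻ : GItem → ∣ alg G ∣ → Set
      l⁻ x c = Σ Match λ μ → M μ × Σ (RItem μ) λ y → Σ (Rule.InL (rl μ) y) λ p →
               Matching.mI (mt μ) y p ≡ x ×
               hImg (Matching.mAlg (mt μ)) (λ t → Rule.lL (rl μ) y t × ¬ Rule.lK (rl μ) y t) c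

      -- (l_R(y) is taken to be ∅ when y ∉ R)
      l⁺ : GItem → ∣ alg G ∣ → Set
      l⁺ x c = Σ Match λ μ → M μ × Σ (RItem μ) λ y → Σ (Rule.InL (rl μ) y) λ p →
               Matching.mI (mt μ) y p ≡ x ×
               hImg (Matching.mAlg (mt μ)) (λ t → Rule.InR (rl μ) y × Rule.lR (rl μ) y t × ¬ Rule.lK (rl μ) y t) c

    -- G ∖ (V,A,l): the largest subgraph of G disjoint from V, A, l
    -- (membership predicates over the carriers of G)
    module _ (Vd : V G → Set) (Ad : A G → Set) (ld : GItem → ∣ alg G ∣ → Set) where
      DelV : V G → Set
      DelV v = ¬ Vd v
      DelA : A G → Set
      DelA a = ¬ Ad a × ¬ Vd (Graph.src G a) × ¬ Vd (Graph.tgt G a)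
      DelIn : GItem → Set
      DelIn (inj₁ v) = DelV v
      DelIn (inj₂ a) = DelA a
      DelLab : GItem → ∣ alg G ∣ → Set
      DelLab x c = lab G x c × ¬ ld x c

    -- fresh items (x , μ)
    FV : Set
    FV = Σ Match λ μ → Fin (Rule.nV (rl μ))
    FA : Set
    FA = Σ Match λ μ → Fin (Rule.nA (rl μ))

    liftK : {B C : Set} (b : Bool) → (T b → B) → C → B ⊎ C
    liftK true  f _ = inj₁ (f _)
    liftK false _ c = inj₂ c

    up : (μ : Match) → Fin (Rule.nV (rl μ)) → V G ⊎ FV
    up μ y = liftK (Rule.KV (rl μ) y)
                   (λ p → Matching.mV (mt μ) y (Rule.KV⊆LV (rl μ) y p)) (μ , y)

    emb : GItem → (V G ⊎ FV) ⊎ (A G ⊎ FA)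
    emb (inj₁ v) = inj₁ (inj₁ v)
    emb (inj₂ a) = inj₂ (inj₁ a)

    module _ (M : MSet) where

      -- x ∈ μ(R_μ ⊓ K_μ) for some μ ∈ M  (the non-fresh part of ⨆ μ↑(R_μ))
      InUp : GItem → Set
      InUp x = Σ Match λ μ → M μ × Σ (RItem μ) λ y → Rule.InR (rl μ) y ×
               Σ (Rule.InK (rl μ) y) λ p → Matching.mI (mt μ) y (K⊆L (rl μ) y p) ≡ x

      LabUp : GItem → ∣ alg G ∣ → Set
      LabUp x c = Σ Match λ μ → M μ × Σ (RItem μ) λ y → Rule.InR (rl μ) y ×
                  Σ (Rule.InK (rl μ) y) λ p → Matching.mI (mt μ) y (K⊆L (rl μ) y p) ≡ x ×
                  hImg (Matching.mAlg (mt μ)) (Rule.lR (rl μ) y) c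

      InFresh : (μ : Match) → RItem μ → Set
      InFresh μ y = M μ × Rule.InR (rl μ) y × ¬ Rule.InK (rl μ) y

      LabFresh : (μ : Match) → RItem μ → ∣ alg G ∣ → Set
      LabFresh μ y c = InFresh μ y × hImg (Matching.mAlg (mt μ)) (Rule.lR (rl μ) y) c

      -- G_M = (G ∖ (V⁻_M, A⁻_M, l⁻_M)) ⊔ ⨆_{μ ∈ M} μ↑(R_μ)
      GM : PGraph (alg G) (V G ⊎ FV) (A G ⊎ FA)
      GM = record
        { src = λ { (inj₁ a) → inj₁ (Graph.src G a)
                  ; (inj₂ (μ , b)) → up μ (Rule.rsrc (rl μ) b) }
        ; tgt = λ { (inj₁ a) → inj₁ (Graph.tgt G a)
                  ; (inj₂ (μ , b)) → up μ (Rule.rtgt (rl μ) b) }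
        ; Vs  = λ { (inj₁ v) → DelIn (V⁻ M) (A⁻ M) (l⁻ M) (inj₁ v) ⊎ InUp (inj₁ v)
                  ; (inj₂ (μ , y)) → InFresh μ (inj₁ y) }
        ; As  = λ { (inj₁ a) → DelIn (V⁻ M) (A⁻ M) (l⁻ M) (inj₂ a) ⊎ InUp (inj₂ a)
                  ; (inj₂ (μ , b)) → InFresh μ (inj₂ b) }
        ; lab = λ { (inj₁ (inj₁ v)) c → (DelIn (V⁻ M) (A⁻ M) (l⁻ M) (inj₁ v) × DelLab (V⁻ M) (A⁻ M) (l⁻ M) (inj₁ v) c)
                                        ⊎ LabUp (inj₁ v) c
                  ; (inj₂ (inj₁ a)) c → (DelIn (V⁻ M) (A⁻ M) (l⁻ M) (inj₂ a) × DelLab (V⁻ M) (A⁻ M) (l⁻ M) (inj₂ a) c)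
                                        ⊎ LabUp (inj₂ a) c
                  ; (inj₁ (inj₂ (μ , y))) c → LabFresh μ (inj₁ y) c
                  ; (inj₂ (inj₂ (μ , b))) c → LabFresh μ (inj₂ b) c }
        }

    -- a graph P over the carrier of G_M is disjoint from (V, A, l) (V, A, l
    -- given on G; fresh items lie outside G, where l is ∅)
    DisjointFrom : PGraph (alg G) (V G ⊎ FV) (A G ⊎ FA) → (V G → Set) → (A G → Set) → (GItem → ∣ alg G ∣ → Set) → Set
    DisjointFrom P Vd Ad ld =
        (∀ v → InP P (inj₁ (inj₁ v)) → ¬ Vd v)
      × (∀ a → InP P (inj₂ (inj₁ a)) → ¬ Ad a)
      × (∀ x → InP P (emb x) → ∀ c → PGraph.lab P (emb x) c → ¬ ld x c)

    Regular : MSet → Set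
    Regular M = DisjointFrom (GM M) (V⁻ M) (A⁻ M) (l⁻ M)

    EffectiveDeletion : MSet → Set
    EffectiveDeletion M = DisjointFrom (GM M) (V⁻ M) (A⁻ M) (λ x c → l⁻ M x c × ¬ l⁺ M x c)

    record SubG : Set₁ where
      field
        sV : V G → Set
        sA : A G → Set
        sl : GItem → ∣ alg G ∣ → Set

    InS : SubG → GItem → Set
    InS H (inj₁ v) = SubG.sV H v
    InS H (inj₂ a) = SubG.sA H a

    _⊓_ : SubG → SubG → SubG
    H ⊓ F = record { sV = λ v → SubG.sV H v × SubG.sV F v
                   ; sA = λ a → SubG.sA H a × SubG.sA F a
                   ; sl = λ x c → SubG.sl H x c × SubG.sl F x c }

    _◁_ : SubG → SubG → Set
    H ◁ F = (∀ v → SubG.sV H v → SubG.sV F v)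
          × (∀ a → SubG.sA H a → SubG.sA F a)
          × (∀ x → InS H x → ∀ c → SubG.sl H x c → SubG.sl F x c)

    image : (μ : Match) → (RItem μ → Set) → (RItem μ → ∣ TermAlg (Rule.X (rl μ)) ∣ → Set) → SubG
    image μ FI Fl = record
      { sV = λ v → Σ (Fin (Rule.nV (rl μ))) λ y → Σ (T (Rule.LV (rl μ) y)) λ p →
                   FI (inj₁ y) × Matching.mV (mt μ) y p ≡ v
      ; sA = λ a → Σ (Fin (Rule.nA (rl μ))) λ y → Σ (T (Rule.LA (rl μ) y)) λ p →
                   FI (inj₂ y) × Matching.mA (mt μ) y p ≡ a
      ; sl = λ x c → Σ (RItem μ) λ y → Σ (Rule.InL (rl μ) y) λ p →
                   FI y × Matching.mI (mt μ) y p ≡ x × hImg (Matching.mAlg (mt μ)) (Fl y) c }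

    imgL imgK imgRK : Match → SubG
    imgL μ  = image μ (Rule.InL (rl μ)) (Rule.lL (rl μ))
    imgK μ  = image μ (Rule.InK (rl μ)) (Rule.lK (rl μ))
    imgRK μ = image μ (λ y → Rule.InR (rl μ) y × Rule.InK (rl μ) y)
                      (λ y t → Rule.lR (rl μ) y t × Rule.lK (rl μ) y t)

    ParallelCoherent : MSet → Set
    ParallelCoherent M = ∀ μ ν → M μ → M ν → (imgRK ν ⊓ imgL μ) ◁ imgK μ

-- Since the rules are unlabeled, no matching deletes an attribute, so l⁻_M is
-- empty and the attribute clauses of all three properties hold trivially.  What
-- remains of each of them is the same statement: no vertex or arrow preserved by
-- some ν ∈ M (an item of ν(R_ν ⊓ K_ν)) is deleted by some μ ∈ M.  For parallel
-- coherence this uses injectivity of μ: an item of μ(L_μ) is the image of a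
-- single item of L_μ, which lies in K_μ or not.
module Submission where

open import Defs
open import Data.Nat using (ℕ)
open import Data.Fin using (Fin)
open import Data.Bool using (Bool)
open import Data.Bool.Properties using (T-irrelevant)
open import Data.Product using (Σ; _×_; _,_; proj₁; proj₂)
open import Data.Sum using (_⊎_; inj₁; inj₂)
open import Data.Sum.Properties using (inj₁-injective; inj₂-injective)
open import Data.Empty using (⊥-elim)
open import Relation.Nullary using (¬_; Dec; yes; no)
open import Relation.Nullary.Decidable using (T?)
open import Relation.Binary.PropositionalEquality using (_≡_; sym; trans; cong; subst)
open import Function.Bundles using (_⇔_; mk⇔)
open import Function.Construct.Symmetry using (⇔-sym)
open import Function.Construct.Composition using (_⇔-∘_)

module _ (Sig : Signature) (𝒱 : Variables Sig) where
  open Theory Sig 𝒱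

  Mem-irrelevant : {n m : ℕ} {PV : Fin n → Bool} {PA : Fin m → Bool} →
                   ∀ y (p q : Mem PV PA y) → p ≡ q
  Mem-irrelevant (inj₁ v) p q = T-irrelevant p q
  Mem-irrelevant (inj₂ a) p q = T-irrelevant p q

  Mem? : {n m : ℕ} {PV : Fin n → Bool} {PA : Fin m → Bool} →
         ∀ y → Dec (Mem PV PA y)
  Mem? {PV = PV} (inj₁ v) = T? (PV v)
  Mem? {PA = PA} (inj₂ a) = T? (PA a)

  module _ {r : Rule} {G : Graph} (μ : Matching r G) where
    open Rule r
    open Matching μ

    mI-injective : ∀ {y y'} (p : InL y) (p' : InL y') → mI y p ≡ mI y' p' → y ≡ y'
    mI-injective {inj₁ v} {inj₁ v'} p p' eq = cong inj₁ (injV v p v' p' (inj₁-injective eq))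
    mI-injective {inj₂ a} {inj₂ a'} p p' eq = cong inj₂ (injA a p a' p' (inj₂-injective eq))
    mI-injective {inj₁ _} {inj₂ _} _ _ ()
    mI-injective {inj₂ _} {inj₁ _} _ _ ()

    mI-irrelevant : ∀ y (p q : InL y) → mI y p ≡ mI y q
    mI-irrelevant y p q = cong (mI y) (Mem-irrelevant y p q)

    InImage : (Fin nV ⊎ Fin nA → Set) → Graph.V G ⊎ Graph.A G → Set
    InImage F x = Σ (Fin nV ⊎ Fin nA) λ y → Σ (InL y) λ p → F y × mI y p ≡ x

    kept-or-deleted : ∀ {F x} → InImage F x → InImage InK x ⊎ InImage (λ y → ¬ InK y) x
    kept-or-deleted (y , p , _ , eq) with Mem? y
    ... | yes k = inj₁ (y , p , k , eq)
    ... | no ¬k = inj₂ (y , p , ¬k , eq)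

    kept-not-deleted : ∀ {x} → InImage InK x → ¬ InImage (λ y → ¬ InK y) x
    kept-not-deleted (y , p , k , eq) (y' , p' , ¬k , eq') =
      ¬k (subst InK (mI-injective p p' (trans eq (sym eq'))) k)

    InImage-InL : ∀ {F x} → InImage F x → InImage InL x
    InImage-InL (y , p , _ , eq) = y , p , p , eq

  module _ {k : ℕ} (ℛ : Fin k → Rule) (G : Graph) where
    open Parallel ℛ G

    Deleted : MSet → GItem → Set
    Deleted M (inj₁ v) = V⁻ M v
    Deleted M (inj₂ a) = A⁻ M a

    NoPreservedDeleted : MSet → Set
    NoPreservedDeleted M = ∀ x → InUp M x → ¬ Deleted M x

    module _ {M : MSet} where

      deleted-by : ∀ {μ x} → M μ → InImage (mt μ) (λ y → ¬ Rule.InK (rl μ) y) x → Deleted M x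
      deleted-by {μ} {inj₁ v} mμ (inj₁ y , p , ¬k , eq) = μ , mμ , y , p , ¬k , inj₁-injective eq
      deleted-by {μ} {inj₂ a} mμ (inj₂ y , p , ¬k , eq) = μ , mμ , y , p , ¬k , inj₂-injective eq
      deleted-by {x = inj₁ _} _ (inj₂ _ , _ , _ , ())
      deleted-by {x = inj₂ _} _ (inj₁ _ , _ , _ , ())

      deleted-witness : ∀ x → Deleted M x →
                        Σ Match λ μ → M μ × InImage (mt μ) (λ y → ¬ Rule.InK (rl μ) y) x
      deleted-witness (inj₁ v) (μ , mμ , y , p , ¬k , eq) = μ , mμ , inj₁ y , p , ¬k , cong inj₁ eq
      deleted-witness (inj₂ a) (μ , mμ , y , p , ¬k , eq) = μ , mμ , inj₂ y , p , ¬k , cong inj₂ eq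

      preserved-by : ∀ {ν x} → M ν →
                     InImage (mt ν) (λ y → Rule.InR (rl ν) y × Rule.InK (rl ν) y) x → InUp M x
      preserved-by {ν} mν (y , p , (r , k) , eq) =
        ν , mν , y , r , k , trans (mI-irrelevant (mt ν) y _ p) eq

      preserved-witness : ∀ {x} → InUp M x →
        Σ Match λ ν → M ν × InImage (mt ν) (λ y → Rule.InR (rl ν) y × Rule.InK (rl ν) y) x
      preserved-witness (ν , mν , y , r , k , eq) = ν , mν , y , K⊆L (rl ν) y k , (r , k) , eq

    module _ (μ : Match) {FI : RItem μ → Set} {Fl : RItem μ → ∣ TermAlg (Rule.X (rl μ)) ∣ → Set} where

      image→InImage : ∀ x → InS (image μ FI Fl) x → InImage (mt μ) FI x
      image→InImage (inj₁ v) (y , p , f , eq) = inj₁ y , p , f , cong inj₁ eq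
      image→InImage (inj₂ a) (y , p , f , eq) = inj₂ y , p , f , cong inj₂ eq

      InImage→image : ∀ x → InImage (mt μ) FI x → InS (image μ FI Fl) x
      InImage→image (inj₁ v) (inj₁ y , p , f , eq) = y , p , f , inj₁-injective eq
      InImage→image (inj₂ a) (inj₂ y , p , f , eq) = y , p , f , inj₂-injective eq
      InImage→image (inj₁ _) (inj₂ _ , _ , _ , ())
      InImage→image (inj₂ _) (inj₁ _ , _ , _ , ())

    module _ {H F : SubG} where

      InS-⊓ : ∀ x → InS (H ⊓ F) x → InS H x × InS F x
      InS-⊓ (inj₁ v) both = both
      InS-⊓ (inj₂ a) both = both

      ⊓-InS : ∀ x → InS H x → InS F x → InS (H ⊓ F) x
      ⊓-InS (inj₁ v) h f = h , f
      ⊓-InS (inj₂ a) h f = h , f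

      ◁-InS : H ◁ F → ∀ x → InS H x → InS F x
      ◁-InS (vs , _ , _) (inj₁ v) = vs v
      ◁-InS (_ , as , _) (inj₂ a) = as a

      InS-◁ : (∀ x → InS H x → InS F x) →
              (∀ x → InS H x → ∀ c → SubG.sl H x c → SubG.sl F x c) → H ◁ F
      InS-◁ items labels = (λ v → items (inj₁ v)) , (λ a → items (inj₂ a)) , labels

    module _ (unlabeled : ∀ i → UnlabeledRule (ℛ i)) {M : MSet} where

      l⁻-empty : ∀ x c → ¬ l⁻ M x c
      l⁻-empty x (s , _) (μ , _ , y , p , _ , a , (l , _) , _) =
        proj₁ (unlabeled (proj₁ μ)) y p (s , a) l

      imgRK-unlabeled : ∀ ν x c → ¬ SubG.sl (imgRK ν) x c
      imgRK-unlabeled ν x (s , _) (y , _ , (r , _) , _ , a , (l , _) , _) =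
        proj₂ (proj₂ (unlabeled (proj₁ ν))) y r (s , a) l

      disjoint⇔noPreservedDeleted : ∀ {ld} → (∀ x c → ld x c → l⁻ M x c) →
        DisjointFrom (GM M) (V⁻ M) (A⁻ M) ld ⇔ NoPreservedDeleted M
      disjoint⇔noPreservedDeleted {ld} ld⊆l⁻ = mk⇔ to from
        where
        to : DisjointFrom (GM M) (V⁻ M) (A⁻ M) ld → NoPreservedDeleted M
        to (vs , _ , _) (inj₁ v) up = vs v (inj₂ up)
        to (_ , as , _) (inj₂ a) up = as a (inj₂ up)

        from : NoPreservedDeleted M → DisjointFrom (GM M) (V⁻ M) (A⁻ M) ld
        from npd = vertices , arrows , λ x _ c _ l → l⁻-empty x c (ld⊆l⁻ x c l)
          where
          vertices : ∀ v → InP (GM M) (inj₁ (inj₁ v)) → ¬ V⁻ M v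
          vertices v (inj₁ undeleted) = undeleted
          vertices v (inj₂ up)        = npd (inj₁ v) up
          arrows : ∀ a → InP (GM M) (inj₂ (inj₁ a)) → ¬ A⁻ M a
          arrows a (inj₁ (undeleted , _)) = undeleted
          arrows a (inj₂ up)              = npd (inj₂ a) up

      coherent⇔noPreservedDeleted : ParallelCoherent M ⇔ NoPreservedDeleted M
      coherent⇔noPreservedDeleted = mk⇔ to from
        where
        to : ParallelCoherent M → NoPreservedDeleted M
        to pc x up del with preserved-witness up | deleted-witness x del
        ... | ν , mν , kept | μ , mμ , gone =
          kept-not-deleted (mt μ) (image→InImage μ x (◁-InS (pc μ ν mμ mν) x both)) gone
          where
          both : InS (imgRK ν ⊓ imgL μ) x
          both = ⊓-InS x (InImage→image ν x kept)
                         (InImage→image μ x (InImage-InL (mt μ) gone))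

        from : NoPreservedDeleted M → ParallelCoherent M
        from npd μ ν mμ mν = InS-◁ items λ x _ c both → ⊥-elim (imgRK-unlabeled ν x c (proj₁ both))
          where
          items : ∀ x → InS (imgRK ν ⊓ imgL μ) x → InS (imgK μ) x
          items x both with InS-⊓ x both
          ... | rk , l with kept-or-deleted (mt μ) (image→InImage μ x l)
          ...   | inj₁ kept = InImage→image μ x kept
          ...   | inj₂ gone =
                  ⊥-elim (npd x (preserved-by mν (image→InImage ν x rk)) (deleted-by mμ gone))

-- G need not be unlabeled: only l⁻_M enters, and it is empty because the rules are.
corollary3 : (Sig : Signature) (𝒱 : Variables Sig) →
    let open Theory Sig 𝒱 in
    {k : ℕ} (ℛ : Fin k → Rule) → (∀ i → UnlabeledRule (ℛ i)) →
    (G : Graph) → Unlabeled G →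
    let open Parallel ℛ G in
    (M : Match → Set) →
      (Regular M ⇔ ParallelCoherent M) × (ParallelCoherent M ⇔ EffectiveDeletion M)
corollary3 Sig 𝒱 ℛ unlabeled G _ M =
  ⇔-sym coherent⇔NPD ⇔-∘ regular⇔NPD , ⇔-sym effective⇔NPD ⇔-∘ coherent⇔NPD
  where
  open Theory Sig 𝒱
  open Parallel ℛ G

  coherent⇔NPD : ParallelCoherent M ⇔ NoPreservedDeleted Sig 𝒱 ℛ G M
  coherent⇔NPD = coherent⇔noPreservedDeleted Sig 𝒱 ℛ G unlabeled

  regular⇔NPD : Regular M ⇔ NoPreservedDeleted Sig 𝒱 ℛ G M
  regular⇔NPD = disjoint⇔noPreservedDeleted Sig 𝒱 ℛ G unlabeled λ _ _ l → l

  effective⇔NPD : EffectiveDeletion M ⇔ NoPreservedDeleted Sig 𝒱 ℛ G M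
  effective⇔NPD = disjoint⇔noPreservedDeleted Sig 𝒱 ℛ G unlabeled λ _ _ → proj₁
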